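{- Let $\mathcal{R}$ be a rewrite system on terms. The Cut rule is redundant in (full) asymmetric sequent calculus modulo $\mathcal{R}$ (i.e. every sequent provable in this system has a proof not using the Cut rule) if and only if $\mathcal{R}$ is confluent.
   Context: Fix a first-order language with connectives $\Rightarrow, \wedge, \vee, \bot$ and quantifiers $\forall, \exists$. A rewrite rule is a pair of terms $l \rightarrow r$ with $l$ not a variable; a rewrite system is a set of rules. $\rightarrow^{1}$ is the smallest relation on terms and propositions compatible with their structure and containing $\theta l \rightarrow^{1} \theta r$ for every substitution $\theta$ and rule $l \rightarrow r$ (so rewriting acts on terms inside propositions and preserves the logical structure of propositions); $\rightarrow^{*}$ is its reflexive-transitive closure and $\leftarrow^{*}$ its converse. $\mathcal{R}$ is confluent if whenever $u \leftarrow^{*} t \rightarrow^{*} v$ there is $w$ with $u \rightarrow^{*} w \leftarrow^{*} v$. Sequents $\Gamma \vdash \Delta$ have finite multisets of propositions. The rules of asymmetric sequent calculus modulo $\mathcal{R}$ are: Axiom: $\Gamma, A_1 \vdash A_2, \Delta$ if $A_1 \rightarrow^{*} A \leftarrow^{*} A_2$ for some $A$; Cut: from $\Gamma \vdash C_1, \Delta$ and $\Gamma, C_2 \vdash \Delta$ infer $\Gamma \vdash \Delta$ if $C_1 \leftarrow^{*} C \rightarrow^{*} C_2$ for some $C$; contraction-left (resp. right): from $\Gamma, A_1, A_2 \vdash \Delta$ (resp. $\Gamma \vdash A_1, A_2, \Delta$) infer $\Gamma, A \vdash \Delta$ (resp. $\Gamma \vdash A, \Delta$) if $A_1 \leftarrow^{*}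 A \rightarrow^{*} A_2$; weakening-left/right: from $\Gamma \vdash \Delta$ infer $\Gamma, A \vdash \Delta$ / $\Gamma \vdash A, \Delta$; $\Rightarrow$-left: from $\Gamma \vdash A, \Delta$ and $\Gamma, B \vdash \Delta$ infer $\Gamma, C \vdash \Delta$ if $C \rightarrow^{*} (A \Rightarrow B)$; $\Rightarrow$-right: from $\Gamma, A \vdash B, \Delta$ infer $\Gamma \vdash C, \Delta$ if $C \rightarrow^{*} (A \Rightarrow B)$; $\wedge$-left: from $\Gamma, A, B \vdash \Delta$ infer $\Gamma, C \vdash \Delta$ if $C \rightarrow^{*} (A \wedge B)$; $\wedge$-right: from $\Gamma \vdash A, \Delta$ and $\Gamma \vdash B, \Delta$ infer $\Gamma \vdash C, \Delta$ if $C \rightarrow^{*} (A \wedge B)$; $\vee$-left: from $\Gamma, A \vdash \Delta$ and $\Gamma, B \vdash \Delta$ infer $\Gamma, C \vdash \Delta$ if $C \rightarrow^{*} (A \vee B)$; $\vee$-right: from $\Gamma \vdash A, B, \Delta$ infer $\Gamma \vdash C, \Delta$ if $C \rightarrow^{*} (A \vee B)$; $\bot$-left: $\Gamma, A \vdash \Delta$ if $A \rightarrow^{*} \bot$; $\forall$-left: from $\Gamma, [t/x]A \vdash \Delta$ infer $\Gamma, B \vdash \Delta$ if $B \rightarrow^{*} \forall x\, A$; $\forall$-right: from $\Gamma \vdash A, \Delta$ infer $\Gamma \vdash B, \Delta$ if $B \rightarrow^{*} \forall x\, A$ and $x$ is not free in $\Gamma, \Delta$; $\exists$-left: from $\Gamma,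 A \vdash \Delta$ infer $\Gamma, B \vdash \Delta$ if $B \rightarrow^{*} \exists x\, A$ and $x$ is not free in $\Gamma, \Delta$; $\exists$-right: from $\Gamma \vdash [t/x]A, \Delta$ infer $\Gamma \vdash B, \Delta$ if $B \rightarrow^{*} \exists x\, A$. -}

module Defs where

open import Data.Nat using (ℕ; zero; suc; _≤_)
open import Data.Bool using (Bool; true; false)
open import Data.Vec using (Vec; []; _∷_)
open import Data.List using (List; map) renaming (_∷_ to _,,_)
open import Data.Product using (_×_; ∃)
open import Relation.Binary.PropositionalEquality using (_≡_; _≢_)
open import Relation.Binary.Construct.Closure.ReflexiveTransitive using (Star)
open import Data.List.Relation.Binary.Permutation.Propositional using (_↭_)

record Signature : Set₁ where
  field
    Fun  : Set
    arF  : Fun → ℕ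
    Pred : Set
    arP  : Pred → ℕ
open Signature public

module _ {S : Signature} where

  -- Terms, variables as de Bruijn indices.
  data Term : Set where
    var : ℕ → Term
    fun : (f : Fun S) → Vec Term (arF S f) → Term

  Subst : Set
  Subst = ℕ → Term

  mutual
    sub : Subst → Term → Term
    sub σ (var x)    = σ x
    sub σ (fun f ts) = fun f (subs σ ts)

    subs : ∀ {n} → Subst → Vec Term n → Vec Term n
    subs σ []       = []
    subs σ (t ∷ ts) = sub σ t ∷ subs σ ts

  shift : Term → Term
  shift = sub (λ x → var (suc x))

  lift : Subst → Subst
  lift σ zero    = var zero
  lift σ (suc x) = shift (σ x)

  -- Propositions; ∀' and ∃' bind de Bruijn index 0.
  data Prop : Set where
    atom : (p : Pred S) → Vec Term (arP S p) → Prop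
    ⊥'   : Prop
    _⇒_  : Prop → Prop → Prop
    _∧_  : Prop → Prop → Prop
    _∨_  : Prop → Prop → Prop
    ∀'   : Prop → Prop
    ∃'   : Prop → Prop

  subP : Subst → Prop → Prop
  subP σ (atom p ts) = atom p (subs σ ts)
  subP σ ⊥'          = ⊥'
  subP σ (A ⇒ B)     = subP σ A ⇒ subP σ B
  subP σ (A ∧ B)     = subP σ A ∧ subP σ B
  subP σ (A ∨ B)     = subP σ A ∨ subP σ B
  subP σ (∀' A)      = ∀' (subP (lift σ) A)
  subP σ (∃' A)      = ∃' (subP (lift σ) A)

  shiftP : Prop → Prop
  shiftP = subP (λ x → var (suc x))

  inst-sub : Term → Subst
  inst-sub t zero    = t
  inst-sub t (suc x) = var x

  inst : Term → Prop → Prop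
  inst t = subP (inst-sub t)

  record RewriteSystem : Set₁ where
    field
      Rule       : Term → Term → Set
      lhs-nonvar : ∀ {l r} → Rule l r → ∀ x → l ≢ var x
  open RewriteSystem public

module _ {S : Signature} (R : RewriteSystem {S}) where

  mutual
    data _⟶_ : Term {S} → Term {S} → Set where
      root : ∀ {l r} → Rule R l r → (θ : Subst) → sub θ l ⟶ sub θ r
      arg  : ∀ {f ts us} → ts ⟶ᵛ us → fun f ts ⟶ fun f us

    data _⟶ᵛ_ : ∀ {n} → Vec (Term {S}) n → Vec (Term {S}) n → Set where
      here  : ∀ {n t u} {ts : Vec Term n} → t ⟶ u → (t ∷ ts) ⟶ᵛ (u ∷ ts)
      there : ∀ {n t} {ts us : Vec Term n} → ts ⟶ᵛ us → (t ∷ ts) ⟶ᵛ (t ∷ us)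

  data _⟶ₚ_ : Prop {S} → Prop {S} → Set where
    atomₛ : ∀ {p ts us} → ts ⟶ᵛ us → atom p ts ⟶ₚ atom p us
    ⇒ₗ : ∀ {A A' B} → A ⟶ₚ A' → (A ⇒ B) ⟶ₚ (A' ⇒ B)
    ⇒ᵣ : ∀ {A B B'} → B ⟶ₚ B' → (A ⇒ B) ⟶ₚ (A ⇒ B')
    ∧ₗ : ∀ {A A' B} → A ⟶ₚ A' → (A ∧ B) ⟶ₚ (A' ∧ B)
    ∧ᵣ : ∀ {A B B'} → B ⟶ₚ B' → (A ∧ B) ⟶ₚ (A ∧ B')
    ∨ₗ : ∀ {A A' B} → A ⟶ₚ A' → (A ∨ B) ⟶ₚ (A' ∨ B)
    ∨ᵣ : ∀ {A B B'} → B ⟶ₚ B' → (A ∨ B) ⟶ₚ (A ∨ B')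
    ∀ₛ : ∀ {A A'} → A ⟶ₚ A' → ∀' A ⟶ₚ ∀' A'
    ∃ₛ : ∀ {A A'} → A ⟶ₚ A' → ∃' A ⟶ₚ ∃' A'

  _⟶*_ : Term {S} → Term {S} → Set
  _⟶*_ = Star _⟶_

  _⟶ₚ*_ : Prop {S} → Prop {S} → Set
  _⟶ₚ*_ = Star _⟶ₚ_

  Confluent : Set
  Confluent = ∀ {t u v} → t ⟶* u → t ⟶* v → ∃ λ w → (u ⟶* w) × (v ⟶* w)

  -- Asymmetric sequent calculus modulo R.  The flag b says whether Cut may
  -- be used.  Sequents are lists taken up to permutation (= multisets).
  data Pf (b : Bool) : List (Prop {S}) → List (Prop {S}) → Set where
    perm   : ∀ {Γ Γ' Δ Δ'} → Γ ↭ Γ' → Δ ↭ Δ' → Pf b Γ Δ → Pf b Γ' Δ'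
    axiom  : ∀ {Γ Δ A₁ A₂ A} → A₁ ⟶ₚ* A → A₂ ⟶ₚ* A → Pf b (A₁ ,, Γ) (A₂ ,, Δ)
    cut    : ∀ {Γ Δ C C₁ C₂} → b ≡ true → C ⟶ₚ* C₁ → C ⟶ₚ* C₂ →
             Pf b Γ (C₁ ,, Δ) → Pf b (C₂ ,, Γ) Δ → Pf b Γ Δ
    contrL : ∀ {Γ Δ A A₁ A₂} → A ⟶ₚ* A₁ → A ⟶ₚ* A₂ →
             Pf b (A₁ ,, A₂ ,, Γ) Δ → Pf b (A ,, Γ) Δ
    contrR : ∀ {Γ Δ A A₁ A₂} → A ⟶ₚ* A₁ → A ⟶ₚ* A₂ →
             Pf b Γ (A₁ ,, A₂ ,, Δ) → Pf b Γ (A ,, Δ)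
    weakL  : ∀ {Γ Δ A} → Pf b Γ Δ → Pf b (A ,, Γ) Δ
    weakR  : ∀ {Γ Δ A} → Pf b Γ Δ → Pf b Γ (A ,, Δ)
    ⇒L     : ∀ {Γ Δ A B C} → C ⟶ₚ* (A ⇒ B) →
             Pf b Γ (A ,, Δ) → Pf b (B ,, Γ) Δ → Pf b (C ,, Γ) Δ
    ⇒R     : ∀ {Γ Δ A B C} → C ⟶ₚ* (A ⇒ B) →
             Pf b (A ,, Γ) (B ,, Δ) → Pf b Γ (C ,, Δ)
    ∧L     : ∀ {Γ Δ A B C} → C ⟶ₚ* (A ∧ B) →
             Pf b (A ,, B ,, Γ) Δ → Pf b (C ,, Γ) Δ
    ∧R     : ∀ {Γ Δ A B C} → C ⟶ₚ* (A ∧ B) →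
             Pf b Γ (A ,, Δ) → Pf b Γ (B ,, Δ) → Pf b Γ (C ,, Δ)
    ∨L     : ∀ {Γ Δ A B C} → C ⟶ₚ* (A ∨ B) →
             Pf b (A ,, Γ) Δ → Pf b (B ,, Γ) Δ → Pf b (C ,, Γ) Δ
    ∨R     : ∀ {Γ Δ A B C} → C ⟶ₚ* (A ∨ B) →
             Pf b Γ (A ,, B ,, Δ) → Pf b Γ (C ,, Δ)
    ⊥L     : ∀ {Γ Δ A} → A ⟶ₚ* ⊥' → Pf b (A ,, Γ) Δ
    ∀L     : ∀ {Γ Δ A B} (t : Term) → B ⟶ₚ* ∀' A →
             Pf b (inst t A ,, Γ) Δ → Pf b (B ,, Γ) Δ
    -- eigenvariable = index 0, fresh for the shifted Γ, Δ
    ∀R     : ∀ {Γ Δ A B} → B ⟶ₚ* ∀' A →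
             Pf b (map shiftP Γ) (A ,, map shiftP Δ) → Pf b Γ (B ,, Δ)
    ∃L     : ∀ {Γ Δ A B} → B ⟶ₚ* ∃' A →
             Pf b (A ,, map shiftP Γ) (map shiftP Δ) → Pf b (B ,, Γ) Δ
    ∃R     : ∀ {Γ Δ A B} (t : Term) → B ⟶ₚ* ∃' A →
             Pf b Γ (inst t A ,, Δ) → Pf b Γ (B ,, Δ)

  CutRedundant : Set
  CutRedundant = ∀ {Γ Δ} → Pf true Γ Δ → Pf false Γ Δ

-- Rewriting acts on the terms of a proposition and never changes its logical
-- shape.  When R is confluent, joinability ≈ is therefore an equivalence that
-- relates only propositions of the same shape with ≈-related components, so a
-- Gentzen-style calculus whose axioms hold up to ≈ admits cut by the usual
-- induction on the cut formula and the derivations; proofs modulo R translate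
-- into it and back without cuts.  Conversely, if t ↠ u and t ↠ v then
-- P(u) ⊢ P(v) is provable by a cut on P(t); the only cut-free proofs of such an
-- atomic sequent end in an axiom, which provides a common reduct of u and v.

module Submission where

open import Defs
open import Data.Nat using (ℕ; zero; suc; _+_; _≤_; s≤s)
open import Data.Nat.Properties using (≤-refl; m+n≤o⇒m≤o; m+n≤o⇒n≤o)
open import Data.Product using (_×_; ∃; _,_)
open import Data.Bool using (Bool; true; false)
open import Data.Empty using (⊥; ⊥-elim)
open import Data.Unit using (⊤; tt)
open import Data.Vec using (Vec; []; _∷_; replicate)
open import Data.Vec.Relation.Binary.Pointwise.Inductive as Pointwise
  using (Pointwise; []; _∷_)
open import Data.List using (List; []; _∷_; map; _++_)
open import Data.List.Properties using (map-∘; map-cong; map-id)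
open import Data.List.Membership.Propositional using (_∈_)
open import Data.List.Membership.Propositional.Properties
  using (∈-map⁺; ∈-map⁻; ∈-∃++)
open import Data.List.Relation.Unary.Any using (here; there)
open import Data.List.Relation.Unary.All using (All; []; _∷_)
open import Data.List.Relation.Binary.Permutation.Propositional
  using (_↭_; ↭-refl; ↭-sym; prep)
open import Data.List.Relation.Binary.Permutation.Propositional.Properties
  using (All-resp-↭; ∈-resp-↭) renaming (shift to ↭-shift)
open import Relation.Binary.PropositionalEquality
  using (_≡_; refl; sym; trans; cong; cong₂; subst; subst₂)
open import Relation.Binary.Construct.Closure.ReflexiveTransitive
  using (Star; ε; _◅_; _◅◅_; gmap)

Join : {A : Set} → (A → A → Set) → A → A → Set
Join _⟶_ x y = ∃ λ z → Star _⟶_ x z × Star _⟶_ y z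

module Substitution {S : Signature} where

  private variable
    σ τ ρ : Subst {S}
    n : ℕ

  mutual
    sub-fusion : (∀ x → sub σ (τ x) ≡ ρ x) → ∀ t → sub σ (sub τ t) ≡ sub ρ t
    sub-fusion eq (var x)    = eq x
    sub-fusion eq (fun f ts) = cong (fun f) (subs-fusion eq ts)

    subs-fusion : (∀ x → sub σ (τ x) ≡ ρ x) → (ts : Vec (Term {S}) n) →
                  subs σ (subs τ ts) ≡ subs ρ ts
    subs-fusion eq []       = refl
    subs-fusion eq (t ∷ ts) = cong₂ _∷_ (sub-fusion eq t) (subs-fusion eq ts)

  mutual
    sub-identity : (∀ x → σ x ≡ var x) → ∀ t → sub σ t ≡ t
    sub-identity eq (var x)    = eq x
    sub-identity eq (fun f ts) = cong (fun f) (subs-identity eq ts)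

    subs-identity : (∀ x → σ x ≡ var x) → (ts : Vec (Term {S}) n) → subs σ ts ≡ ts
    subs-identity eq []       = refl
    subs-identity eq (t ∷ ts) = cong₂ _∷_ (sub-identity eq t) (subs-identity eq ts)

  lift-fusion : (∀ x → sub σ (τ x) ≡ ρ x) → ∀ x → sub (lift σ) (lift τ x) ≡ lift ρ x
  lift-fusion eq zero    = refl
  lift-fusion {σ} {τ} eq (suc x) = trans (sub-fusion (λ _ → refl) (τ x))
    (trans (sym (sub-fusion (λ _ → refl) (τ x))) (cong shift (eq x)))

  lift-identity : (∀ x → σ x ≡ var x) → ∀ x → lift σ x ≡ var x
  lift-identity eq zero    = refl
  lift-identity eq (suc x) = cong shift (eq x)

  subP-fusion : (∀ x → sub σ (τ x) ≡ ρ x) → ∀ A → subP σ (subP τ A) ≡ subP ρ A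
  subP-fusion eq (atom p ts) = cong (atom p) (subs-fusion eq ts)
  subP-fusion eq ⊥'          = refl
  subP-fusion eq (A ⇒ B)     = cong₂ _⇒_ (subP-fusion eq A) (subP-fusion eq B)
  subP-fusion eq (A ∧ B)     = cong₂ _∧_ (subP-fusion eq A) (subP-fusion eq B)
  subP-fusion eq (A ∨ B)     = cong₂ _∨_ (subP-fusion eq A) (subP-fusion eq B)
  subP-fusion eq (∀' A)      = cong ∀' (subP-fusion (lift-fusion eq) A)
  subP-fusion eq (∃' A)      = cong ∃' (subP-fusion (lift-fusion eq) A)

  subP-identity : (∀ x → σ x ≡ var x) → ∀ A → subP σ A ≡ A
  subP-identity eq (atom p ts) = cong (atom p) (subs-identity eq ts)
  subP-identity eq ⊥'          = refl
  subP-identity eq (A ⇒ B)     = cong₂ _⇒_ (subP-identity eq A) (subP-identity eq B)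
  subP-identity eq (A ∧ B)     = cong₂ _∧_ (subP-identity eq A) (subP-identity eq B)
  subP-identity eq (A ∨ B)     = cong₂ _∨_ (subP-identity eq A) (subP-identity eq B)
  subP-identity eq (∀' A)      = cong ∀' (subP-identity (lift-identity eq) A)
  subP-identity eq (∃' A)      = cong ∃' (subP-identity (lift-identity eq) A)

  wk : Subst {S}
  wk x = var (suc x)

  subP-lift-shiftP : ∀ σ A → subP (lift σ) (shiftP A) ≡ shiftP (subP σ A)
  subP-lift-shiftP σ A = trans (subP-fusion (λ _ → refl) A) (sym (subP-fusion (λ _ → refl) A))

  subP-inst : ∀ σ t A → subP σ (inst t A) ≡ inst (sub σ t) (subP (lift σ) A)
  subP-inst σ t A = trans (subP-fusion (λ _ → refl) A) (sym (subP-fusion inst-lift A))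
    where
    inst-lift : ∀ x → sub (inst-sub (sub σ t)) (lift σ x) ≡ sub σ (inst-sub t x)
    inst-lift zero    = refl
    inst-lift (suc x) = trans (sub-fusion (λ _ → refl) (σ x)) (sub-identity (λ _ → refl) (σ x))

  inst-shiftP : ∀ t A → inst t (shiftP A) ≡ A
  inst-shiftP t A = trans (subP-fusion (λ _ → refl) A) (subP-identity (λ _ → refl) A)

  map-subP-lift-shiftP : ∀ σ Γ → map (subP (lift σ)) (map shiftP Γ) ≡ map shiftP (map (subP σ) Γ)
  map-subP-lift-shiftP σ Γ =
    trans (sym (map-∘ Γ)) (trans (map-cong (subP-lift-shiftP σ) Γ) (map-∘ Γ))

  map-inst-shiftP : ∀ t Γ → map (inst t) (map shiftP Γ) ≡ Γ
  map-inst-shiftP t Γ = trans (sym (map-∘ Γ)) (trans (map-cong (inst-shiftP t) Γ) (map-id Γ))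

  size : Prop {S} → ℕ
  size (atom p ts) = 1
  size ⊥'          = 1
  size (A ⇒ B)     = suc (size A + size B)
  size (A ∧ B)     = suc (size A + size B)
  size (A ∨ B)     = suc (size A + size B)
  size (∀' A)      = suc (size A)
  size (∃' A)      = suc (size A)

  size-subP : ∀ σ A → size (subP σ A) ≡ size A
  size-subP σ (atom p ts) = refl
  size-subP σ ⊥'          = refl
  size-subP σ (A ⇒ B)     = cong₂ (λ a b → suc (a + b)) (size-subP σ A) (size-subP σ B)
  size-subP σ (A ∧ B)     = cong₂ (λ a b → suc (a + b)) (size-subP σ A) (size-subP σ B)
  size-subP σ (A ∨ B)     = cong₂ (λ a b → suc (a + b)) (size-subP σ A) (size-subP σ B)
  size-subP σ (∀' A)      = cong suc (size-subP (lift σ) A)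
  size-subP σ (∃' A)      = cong suc (size-subP (lift σ) A)

module _ {A B : Set} {_⟶₁_ : A → A → Set} {_⟶₂_ : B → B → Set} where

  Join-map : ∀ {x y} (f : A → B) → (∀ {x x'} → x ⟶₁ x' → f x ⟶₂ f x') →
             Join _⟶₁_ x y → Join _⟶₂_ (f x) (f y)
  Join-map f step (z , x↠z , y↠z) = f z , gmap f step x↠z , gmap f step y↠z

  Join-cong₂ : ∀ {C : Set} {_⟶₃_ : C → C → Set} {x x' y y'} (f : A → B → C) →
               (∀ {x x' y} → x ⟶₁ x' → f x y ⟶₃ f x' y) →
               (∀ {x y y'} → y ⟶₂ y' → f x y ⟶₃ f x y') →
               Join _⟶₁_ x x' → Join _⟶₂_ y y' → Join _⟶₃_ (f x y) (f x' y')
  Join-cong₂ f stepˡ stepʳ (a , x↠a , x'↠a) (b , y↠b , y'↠b) =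
    f a b , gmap (λ z → f z _) stepˡ x↠a ◅◅ gmap (f a) stepʳ y↠b
          , gmap (λ z → f z _) stepˡ x'↠a ◅◅ gmap (f a) stepʳ y'↠b

module Rewriting {S : Signature} (R : RewriteSystem {S}) where
  open Substitution

  private variable
    n : ℕ
    t u : Term {S}
    ts ts' us : Vec (Term {S}) n
    A A' B B' : Prop {S}

  infix 4 _↠_ _↠ₚ_ _↓_ _↓ₚ_ _≈_

  _↠_ : Term {S} → Term {S} → Set
  _↠_ = _⟶*_ R

  _↠ₚ_ : Prop {S} → Prop {S} → Set
  _↠ₚ_ = _⟶ₚ*_ R

  _↓_ : Term {S} → Term {S} → Set
  _↓_ = Join (_⟶_ R)

  _↓ₚ_ : Prop {S} → Prop {S} → Set
  _↓ₚ_ = Join (_⟶ₚ_ R)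

  mutual
    ⟶-sub : ∀ σ → _⟶_ R t u → _⟶_ R (sub σ t) (sub σ u)
    ⟶-sub σ (root {l} {r} rule θ) =
      subst₂ (_⟶_ R) (sym (sub-fusion (λ _ → refl) l)) (sym (sub-fusion (λ _ → refl) r))
             (root rule (λ x → sub σ (θ x)))
    ⟶-sub σ (arg steps) = arg (⟶ᵛ-sub σ steps)

    ⟶ᵛ-sub : ∀ σ → _⟶ᵛ_ R ts us → _⟶ᵛ_ R (subs σ ts) (subs σ us)
    ⟶ᵛ-sub σ (here step)   = here (⟶-sub σ step)
    ⟶ᵛ-sub σ (there steps) = there (⟶ᵛ-sub σ steps)

  ↓-refl : t ↓ t
  ↓-refl = _ , ε , ε

  ↓-sym : t ↓ u → u ↓ t
  ↓-sym (w , t↠w , u↠w) = w , u↠w , t↠w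

  -- Since rewriting acts on terms only, under confluence this is exactly
  -- joinability of propositions (see ≈⇒↓ₚ and ↠ₚ⇒≈).
  data _≈_ : Prop {S} → Prop {S} → Set where
    atom : ∀ {p ts us} → Pointwise _↓_ ts us → atom p ts ≈ atom p us
    ⊥'   : ⊥' ≈ ⊥'
    _⇒_  : A ≈ A' → B ≈ B' → (A ⇒ B) ≈ (A' ⇒ B')
    _∧_  : A ≈ A' → B ≈ B' → (A ∧ B) ≈ (A' ∧ B')
    _∨_  : A ≈ A' → B ≈ B' → (A ∨ B) ≈ (A' ∨ B')
    ∀'   : A ≈ A' → ∀' A ≈ ∀' A'
    ∃'   : A ≈ A' → ∃' A ≈ ∃' A'

  ≈-refl : A ≈ A
  ≈-refl {atom p ts} = atom (Pointwise.refl ↓-refl)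
  ≈-refl {⊥'}        = ⊥'
  ≈-refl {A ⇒ B}     = ≈-refl ⇒ ≈-refl
  ≈-refl {A ∧ B}     = ≈-refl ∧ ≈-refl
  ≈-refl {A ∨ B}     = ≈-refl ∨ ≈-refl
  ≈-refl {∀' A}      = ∀' ≈-refl
  ≈-refl {∃' A}      = ∃' ≈-refl

  ≈-sym : A ≈ B → B ≈ A
  ≈-sym (atom ps) = atom (Pointwise.sym ↓-sym ps)
  ≈-sym ⊥'        = ⊥'
  ≈-sym (a ⇒ b)   = ≈-sym a ⇒ ≈-sym b
  ≈-sym (a ∧ b)   = ≈-sym a ∧ ≈-sym b
  ≈-sym (a ∨ b)   = ≈-sym a ∨ ≈-sym b
  ≈-sym (∀' a)    = ∀' (≈-sym a)
  ≈-sym (∃' a)    = ∃' (≈-sym a)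

  ≈-sub : ∀ σ → A ≈ B → subP σ A ≈ subP σ B
  ≈-sub σ (atom ps) = atom (subs-↓ ps)
    where
    subs-↓ : Pointwise _↓_ ts us → Pointwise _↓_ (subs σ ts) (subs σ us)
    subs-↓ []       = []
    subs-↓ (p ∷ ps) = Join-map (sub σ) (⟶-sub σ) p ∷ subs-↓ ps
  ≈-sub σ ⊥'        = ⊥'
  ≈-sub σ (a ⇒ b)   = ≈-sub σ a ⇒ ≈-sub σ b
  ≈-sub σ (a ∧ b)   = ≈-sub σ a ∧ ≈-sub σ b
  ≈-sub σ (a ∨ b)   = ≈-sub σ a ∨ ≈-sub σ b
  ≈-sub σ (∀' a)    = ∀' (≈-sub (lift σ) a)
  ≈-sub σ (∃' a)    = ∃' (≈-sub (lift σ) a)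

  ⟶ₚ-≈ : _⟶ₚ_ R A A' → A' ≈ B → A ≈ B
  ⟶ₚ-≈ (atomₛ step) (atom ps) = atom (⟶ᵛ-↓ step ps)
    where
    ⟶ᵛ-↓ : _⟶ᵛ_ R ts ts' → Pointwise _↓_ ts' us → Pointwise _↓_ ts us
    ⟶ᵛ-↓ (here s)   ((w , t↠w , u↠w) ∷ ps) = (w , s ◅ t↠w , u↠w) ∷ ps
    ⟶ᵛ-↓ (there ss) (p ∷ ps)               = p ∷ ⟶ᵛ-↓ ss ps
  ⟶ₚ-≈ (⇒ₗ step) (a ⇒ b) = ⟶ₚ-≈ step a ⇒ b
  ⟶ₚ-≈ (⇒ᵣ step) (a ⇒ b) = a ⇒ ⟶ₚ-≈ step b
  ⟶ₚ-≈ (∧ₗ step) (a ∧ b) = ⟶ₚ-≈ step a ∧ b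
  ⟶ₚ-≈ (∧ᵣ step) (a ∧ b) = a ∧ ⟶ₚ-≈ step b
  ⟶ₚ-≈ (∨ₗ step) (a ∨ b) = ⟶ₚ-≈ step a ∨ b
  ⟶ₚ-≈ (∨ᵣ step) (a ∨ b) = a ∨ ⟶ₚ-≈ step b
  ⟶ₚ-≈ (∀ₛ step) (∀' a)  = ∀' (⟶ₚ-≈ step a)
  ⟶ₚ-≈ (∃ₛ step) (∃' a)  = ∃' (⟶ₚ-≈ step a)

  ↠ₚ⇒≈ : A ↠ₚ B → A ≈ B
  ↠ₚ⇒≈ ε            = ≈-refl
  ↠ₚ⇒≈ (step ◅ steps) = ⟶ₚ-≈ step (↠ₚ⇒≈ steps)

  ≈⇒↓ₚ : A ≈ B → A ↓ₚ B
  ≈⇒↓ₚ (atom ps) = Join-map (atom _) atomₛ (pointwise⇒↓ᵛ ps)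
    where
    pointwise⇒↓ᵛ : Pointwise _↓_ ts us → Join (_⟶ᵛ_ R) ts us
    pointwise⇒↓ᵛ []       = [] , ε , ε
    pointwise⇒↓ᵛ (p ∷ ps) = Join-cong₂ _∷_ here there p (pointwise⇒↓ᵛ ps)
  ≈⇒↓ₚ ⊥'        = ⊥' , ε , ε
  ≈⇒↓ₚ (a ⇒ b)   = Join-cong₂ _⇒_ ⇒ₗ ⇒ᵣ (≈⇒↓ₚ a) (≈⇒↓ₚ b)
  ≈⇒↓ₚ (a ∧ b)   = Join-cong₂ _∧_ ∧ₗ ∧ᵣ (≈⇒↓ₚ a) (≈⇒↓ₚ b)
  ≈⇒↓ₚ (a ∨ b)   = Join-cong₂ _∨_ ∨ₗ ∨ᵣ (≈⇒↓ₚ a) (≈⇒↓ₚ b)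
  ≈⇒↓ₚ (∀' a)    = Join-map ∀' ∀ₛ (≈⇒↓ₚ a)
  ≈⇒↓ₚ (∃' a)    = Join-map ∃' ∃ₛ (≈⇒↓ₚ a)

module Sequents {S : Signature} (R : RewriteSystem {S}) where
  open Rewriting R

  Ctx : Set
  Ctx = List (Prop {S})

  private variable
    A B C : Prop {S}
    Γ Δ : Ctx
    b : Bool

  -- A G3-style calculus: the principal formula is kept in the premises, so
  -- weakening and contraction are built in, and conversion happens only at
  -- axioms.
  infix 3 _⊢_
  data _⊢_ (Γ Δ : Ctx) : Set
  data Left (Γ Δ : Ctx) : Prop {S} → Set
  data Right (Γ Δ : Ctx) : Prop {S} → Set

  data _⊢_ Γ Δ where
    axiom : A ∈ Γ → B ∈ Δ → A ≈ B → Γ ⊢ Δ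
    left  : C ∈ Γ → Left Γ Δ C → Γ ⊢ Δ
    right : C ∈ Δ → Right Γ Δ C → Γ ⊢ Δ

  data Left Γ Δ where
    ⊥ᴸ : Left Γ Δ ⊥'
    ⇒ᴸ : Γ ⊢ A ∷ Δ → B ∷ Γ ⊢ Δ → Left Γ Δ (A ⇒ B)
    ∧ᴸ : A ∷ B ∷ Γ ⊢ Δ → Left Γ Δ (A ∧ B)
    ∨ᴸ : A ∷ Γ ⊢ Δ → B ∷ Γ ⊢ Δ → Left Γ Δ (A ∨ B)
    ∀ᴸ : ∀ t → inst t A ∷ Γ ⊢ Δ → Left Γ Δ (∀' A)
    ∃ᴸ : A ∷ map shiftP Γ ⊢ map shiftP Δ → Left Γ Δ (∃' A)

  data Right Γ Δ where
    ⇒ᴿ : A ∷ Γ ⊢ B ∷ Δ → Right Γ Δ (A ⇒ B)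
    ∧ᴿ : Γ ⊢ A ∷ Δ → Γ ⊢ B ∷ Δ → Right Γ Δ (A ∧ B)
    ∨ᴿ : Γ ⊢ A ∷ B ∷ Δ → Right Γ Δ (A ∨ B)
    ∀ᴿ : map shiftP Γ ⊢ A ∷ map shiftP Δ → Right Γ Δ (∀' A)
    ∃ᴿ : ∀ t → Γ ⊢ inst t A ∷ Δ → Right Γ Δ (∃' A)

  ∈⇒↭∷ : A ∈ Γ → ∃ λ Γ' → Γ ↭ A ∷ Γ'
  ∈⇒↭∷ {A} A∈Γ with Γ₁ , Γ₂ , refl ← ∈-∃++ A∈Γ = Γ₁ ++ Γ₂ , ↭-shift A Γ₁ Γ₂

  absorbˡ : A ∈ Γ → Pf R b (A ∷ Γ) Δ → Pf R b Γ Δ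
  absorbˡ A∈Γ d with _ , Γ↭ ← ∈⇒↭∷ A∈Γ =
    perm (↭-sym Γ↭) ↭-refl (contrL ε ε (perm (prep _ Γ↭) ↭-refl d))

  absorbʳ : A ∈ Δ → Pf R b Γ (A ∷ Δ) → Pf R b Γ Δ
  absorbʳ A∈Δ d with _ , Δ↭ ← ∈⇒↭∷ A∈Δ =
    perm ↭-refl (↭-sym Δ↭) (contrR ε ε (perm ↭-refl (prep _ Δ↭) d))

  axiom-≈ : A ≈ B → Pf R b (A ∷ Γ) (B ∷ Δ)
  axiom-≈ A≈B with _ , A↠D , B↠D ← ≈⇒↓ₚ A≈B = axiom A↠D B↠D

  mutual
    ⊢⇒Pf : Γ ⊢ Δ → Pf R false Γ Δ
    ⊢⇒Pf (axiom a b j) = absorbˡ a (absorbʳ b (axiom-≈ j))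
    ⊢⇒Pf (left a l)    = absorbˡ a (Left⇒Pf l)
    ⊢⇒Pf (right b r)   = absorbʳ b (Right⇒Pf r)

    Left⇒Pf : Left Γ Δ C → Pf R false (C ∷ Γ) Δ
    Left⇒Pf ⊥ᴸ         = ⊥L ε
    Left⇒Pf (⇒ᴸ d e)   = ⇒L ε (⊢⇒Pf d) (⊢⇒Pf e)
    Left⇒Pf (∧ᴸ d)     = ∧L ε (⊢⇒Pf d)
    Left⇒Pf (∨ᴸ d e)   = ∨L ε (⊢⇒Pf d) (⊢⇒Pf e)
    Left⇒Pf (∀ᴸ t d)   = ∀L t ε (⊢⇒Pf d)
    Left⇒Pf (∃ᴸ d)     = ∃L ε (⊢⇒Pf d)

    Right⇒Pf : Right Γ Δ C → Pf R false Γ (C ∷ Δ)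
    Right⇒Pf (⇒ᴿ d)   = ⇒R ε (⊢⇒Pf d)
    Right⇒Pf (∧ᴿ d e) = ∧R ε (⊢⇒Pf d) (⊢⇒Pf e)
    Right⇒Pf (∨ᴿ d)   = ∨R ε (⊢⇒Pf d)
    Right⇒Pf (∀ᴿ d)   = ∀R ε (⊢⇒Pf d)
    Right⇒Pf (∃ᴿ t d) = ∃R t ε (⊢⇒Pf d)

module CutAdmissibility {S : Signature} (R : RewriteSystem {S}) (confluent : Confluent R) where
  open Substitution
  open Rewriting R
  open Sequents R

  private variable
    n : ℕ
    t u v : Term {S}
    A A' A₁ A₂ B B' C C' C₀ : Prop {S}
    Γ Γ₁ Γ₂ Δ Δ₁ Δ₂ X Y Z : Ctx

  ↓-trans : t ↓ u → u ↓ v → t ↓ v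
  ↓-trans (_ , t↠a , u↠a) (_ , u↠b , v↠b) with c , a↠c , b↠c ← confluent u↠a u↠b =
    c , t↠a ◅◅ a↠c , v↠b ◅◅ b↠c

  ≈-trans : A ≈ B → B ≈ C → A ≈ C
  ≈-trans (atom ps) (atom qs) = atom (Pointwise.trans ↓-trans ps qs)
  ≈-trans ⊥'        ⊥'        = ⊥'
  ≈-trans (a ⇒ b)   (c ⇒ d)   = ≈-trans a c ⇒ ≈-trans b d
  ≈-trans (a ∧ b)   (c ∧ d)   = ≈-trans a c ∧ ≈-trans b d
  ≈-trans (a ∨ b)   (c ∨ d)   = ≈-trans a c ∨ ≈-trans b d
  ≈-trans (∀' a)    (∀' c)    = ∀' (≈-trans a c)
  ≈-trans (∃' a)    (∃' c)    = ∃' (≈-trans a c)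

  ≈-resp : A' ≈ A → A ≈ B → B' ≈ B → A' ≈ B'
  ≈-resp A'≈A A≈B B'≈B = ≈-trans A'≈A (≈-trans A≈B (≈-sym B'≈B))

  -- Absorbs weakening, contraction, exchange and conversion of contexts.
  infix 4 _⊑_
  _⊑_ : Ctx → Ctx → Set
  X ⊑ Y = ∀ {A} → A ∈ X → ∃ λ A' → A' ∈ Y × A' ≈ A

  ⊑-refl : X ⊑ X
  ⊑-refl A∈X = _ , A∈X , ≈-refl

  ⊑-trans : X ⊑ Y → Y ⊑ Z → X ⊑ Z
  ⊑-trans X⊑Y Y⊑Z A∈X with _ , B∈Y , B≈A ← X⊑Y A∈X with _ , C∈Z , C≈B ← Y⊑Z B∈Y =
    _ , C∈Z , ≈-trans C≈B B≈A

  ↭⇒⊑ : X ↭ Y → X ⊑ Y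
  ↭⇒⊑ X↭Y A∈X = _ , ∈-resp-↭ X↭Y A∈X , ≈-refl

  ⊑-cons : A' ∈ Y → A' ≈ A → X ⊑ Y → A ∷ X ⊑ Y
  ⊑-cons A'∈Y A'≈A X⊑Y (here refl) = _ , A'∈Y , A'≈A
  ⊑-cons A'∈Y A'≈A X⊑Y (there B∈X) = X⊑Y B∈X

  ⊑-weaken : X ⊑ Y → X ⊑ B ∷ Y
  ⊑-weaken X⊑Y A∈X with _ , A'∈Y , A'≈A ← X⊑Y A∈X = _ , there A'∈Y , A'≈A

  ⊑-∷ : A' ≈ A → X ⊑ Y → A ∷ X ⊑ A' ∷ Y
  ⊑-∷ A'≈A X⊑Y = ⊑-cons (here refl) A'≈A (⊑-weaken X⊑Y)

  ⊑-under : X ⊑ C ∷ Y → X ⊑ C ∷ B ∷ Y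
  ⊑-under X⊑CY = ⊑-trans X⊑CY (⊑-∷ ≈-refl (⊑-weaken ⊑-refl))

  ⊑-∷-under : B' ≈ B → X ⊑ C ∷ Y → B ∷ X ⊑ C ∷ B' ∷ Y
  ⊑-∷-under B'≈B X⊑CY = ⊑-cons (there (here refl)) B'≈B (⊑-under X⊑CY)

  ⊑-map : ∀ σ → X ⊑ Y → map (subP σ) X ⊑ map (subP σ) Y
  ⊑-map σ X⊑Y σA∈σX with A , A∈X , refl ← ∈-map⁻ (subP σ) σA∈σX
                     with A' , A'∈Y , A'≈A ← X⊑Y A∈X =
    subP σ A' , ∈-map⁺ (subP σ) A'∈Y , ≈-sub σ A'≈A

  mutual
    ⊢-mono : Γ₁ ⊢ Δ₁ → Γ₁ ⊑ Γ → Δ₁ ⊑ Δ → Γ ⊢ Δ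
    ⊢-mono (axiom a b j) g h with _ , a' , ja ← g a | _ , b' , jb ← h b =
      axiom a' b' (≈-resp ja j jb)
    ⊢-mono (left a l)    g h with _ , a' , j ← g a = left a' (Left-mono j l g h)
    ⊢-mono (right b r)   g h with _ , b' , j ← h b = right b' (Right-mono j r g h)

    Left-mono : C' ≈ C → Left Γ₁ Δ₁ C → Γ₁ ⊑ Γ → Δ₁ ⊑ Δ → Left Γ Δ C'
    Left-mono ⊥'      ⊥ᴸ       g h = ⊥ᴸ
    Left-mono (a ⇒ b) (⇒ᴸ d e) g h = ⇒ᴸ (⊢-mono d g (⊑-∷ a h)) (⊢-mono e (⊑-∷ b g) h)
    Left-mono (a ∧ b) (∧ᴸ d)   g h = ∧ᴸ (⊢-mono d (⊑-∷ a (⊑-∷ b g)) h)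
    Left-mono (a ∨ b) (∨ᴸ d e) g h = ∨ᴸ (⊢-mono d (⊑-∷ a g) h) (⊢-mono e (⊑-∷ b g) h)
    Left-mono (∀' a)  (∀ᴸ t d) g h = ∀ᴸ t (⊢-mono d (⊑-∷ (≈-sub (inst-sub t) a) g) h)
    Left-mono (∃' a)  (∃ᴸ d)   g h = ∃ᴸ (⊢-mono d (⊑-∷ a (⊑-map wk g)) (⊑-map wk h))

    Right-mono : C' ≈ C → Right Γ₁ Δ₁ C → Γ₁ ⊑ Γ → Δ₁ ⊑ Δ → Right Γ Δ C'
    Right-mono (a ⇒ b) (⇒ᴿ d)   g h = ⇒ᴿ (⊢-mono d (⊑-∷ a g) (⊑-∷ b h))
    Right-mono (a ∧ b) (∧ᴿ d e) g h = ∧ᴿ (⊢-mono d g (⊑-∷ a h)) (⊢-mono e g (⊑-∷ b h))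
    Right-mono (a ∨ b) (∨ᴿ d)   g h = ∨ᴿ (⊢-mono d g (⊑-∷ a (⊑-∷ b h)))
    Right-mono (∀' a)  (∀ᴿ d)   g h = ∀ᴿ (⊢-mono d (⊑-map wk g) (⊑-∷ a (⊑-map wk h)))
    Right-mono (∃' a)  (∃ᴿ t d) g h = ∃ᴿ t (⊢-mono d g (⊑-∷ (≈-sub (inst-sub t) a) h))

  ⊢-weakenˡ : Γ ⊢ Δ → A ∷ Γ ⊢ Δ
  ⊢-weakenˡ d = ⊢-mono d (⊑-weaken ⊑-refl) ⊑-refl

  ⊢-weakenʳ : Γ ⊢ Δ → Γ ⊢ A ∷ Δ
  ⊢-weakenʳ d = ⊢-mono d ⊑-refl (⊑-weaken ⊑-refl)

  Right-weakenˡ : Right Γ Δ C → Right (A ∷ Γ) Δ C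
  Right-weakenˡ r = Right-mono ≈-refl r (⊑-weaken ⊑-refl) ⊑-refl

  Right-weakenʳ : Right Γ Δ C → Right Γ (A ∷ Δ) C
  Right-weakenʳ r = Right-mono ≈-refl r ⊑-refl (⊑-weaken ⊑-refl)

  mutual
    ⊢-sub : ∀ σ → Γ ⊢ Δ → map (subP σ) Γ ⊢ map (subP σ) Δ
    ⊢-sub σ (axiom a b j) = axiom (∈-map⁺ _ a) (∈-map⁺ _ b) (≈-sub σ j)
    ⊢-sub σ (left a l)    = left (∈-map⁺ _ a) (Left-sub σ l)
    ⊢-sub σ (right b r)   = right (∈-map⁺ _ b) (Right-sub σ r)

    Left-sub : ∀ σ → Left Γ Δ C → Left (map (subP σ) Γ) (map (subP σ) Δ) (subP σ C)
    Left-sub σ ⊥ᴸ       = ⊥ᴸ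
    Left-sub σ (⇒ᴸ d e) = ⇒ᴸ (⊢-sub σ d) (⊢-sub σ e)
    Left-sub σ (∧ᴸ d)   = ∧ᴸ (⊢-sub σ d)
    Left-sub σ (∨ᴸ d e) = ∨ᴸ (⊢-sub σ d) (⊢-sub σ e)
    Left-sub σ (∀ᴸ {A} t d) =
      ∀ᴸ (sub σ t) (subst (λ B → B ∷ _ ⊢ _) (subP-inst σ t A) (⊢-sub σ d))
    Left-sub {Γ} {Δ} σ (∃ᴸ d) =
      ∃ᴸ (subst₂ _⊢_ (cong (_ ∷_) (map-subP-lift-shiftP σ Γ)) (map-subP-lift-shiftP σ Δ)
                 (⊢-sub (lift σ) d))

    Right-sub : ∀ σ → Right Γ Δ C → Right (map (subP σ) Γ) (map (subP σ) Δ) (subP σ C)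
    Right-sub σ (⇒ᴿ d)   = ⇒ᴿ (⊢-sub σ d)
    Right-sub σ (∧ᴿ d e) = ∧ᴿ (⊢-sub σ d) (⊢-sub σ e)
    Right-sub σ (∨ᴿ d)   = ∨ᴿ (⊢-sub σ d)
    Right-sub {Γ} {Δ} σ (∀ᴿ d) =
      ∀ᴿ (subst₂ _⊢_ (map-subP-lift-shiftP σ Γ) (cong (_ ∷_) (map-subP-lift-shiftP σ Δ))
                 (⊢-sub (lift σ) d))
    Right-sub σ (∃ᴿ {A} t d) =
      ∃ᴿ (sub σ t) (subst (λ B → _ ⊢ B ∷ _) (subP-inst σ t A) (⊢-sub σ d))

  ⊢-instˡ : ∀ t → A ∷ map shiftP Γ ⊢ map shiftP Δ → inst t A ∷ Γ ⊢ Δ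
  ⊢-instˡ {Γ = Γ} {Δ} t d =
    subst₂ _⊢_ (cong (_ ∷_) (map-inst-shiftP t Γ)) (map-inst-shiftP t Δ) (⊢-sub (inst-sub t) d)

  ⊢-instʳ : ∀ t → map shiftP Γ ⊢ A ∷ map shiftP Δ → Γ ⊢ inst t A ∷ Δ
  ⊢-instʳ {Γ} {Δ = Δ} t d =
    subst₂ _⊢_ (map-inst-shiftP t Γ) (cong (_ ∷_) (map-inst-shiftP t Δ)) (⊢-sub (inst-sub t) d)

  size-subP-≤ : ∀ σ → size C ≤ n → size (subP σ C) ≤ n
  size-subP-≤ {C} σ = subst (_≤ _) (sym (size-subP σ C))

  -- Induction on the bound n, then on the first derivation until the cut
  -- formula is principal on its right, then on the second derivation; only
  -- cut-principal lowers n.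
  mutual
    ⊢-cut : size C ≤ n → Γ ⊢ C ∷ Δ → C ∷ Γ ⊢ Δ → Γ ⊢ Δ
    ⊢-cut le d₁ d₂ = cut-⊑ le d₁ d₂ ⊑-refl ⊑-refl ⊑-refl ⊑-refl

    cut-⊑ : size C ≤ n → Γ₁ ⊢ Δ₁ → Γ₂ ⊢ Δ₂ →
            Γ₁ ⊑ Γ → Δ₁ ⊑ C ∷ Δ → Γ₂ ⊑ C ∷ Γ → Δ₂ ⊑ Δ → Γ ⊢ Δ
    cut-⊑ le (axiom a b j) d₂ g₁ h₁ g₂ h₂ with g₁ a | h₁ b
    ... | _ , a' , ja | _ , here refl , jb =
      ⊢-mono d₂ (⊑-trans g₂ (⊑-cons a' (≈-resp ja j jb) ⊑-refl)) h₂
    ... | _ , a' , ja | _ , there b' , jb  = axiom a' b' (≈-resp ja j jb)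
    cut-⊑ le (left a l) d₂ g₁ h₁ g₂ h₂ with _ , a' , j ← g₁ a =
      left a' (cut-⊑-Left le j l d₂ g₁ h₁ g₂ h₂)
    cut-⊑ le (right b r) d₂ g₁ h₁ g₂ h₂ with h₁ b
    ... | _ , here refl , j = cut-Right-⊑ le (cut-⊑-Right le j r d₂ g₁ h₁ g₂ h₂) d₂ g₂ h₂
    ... | _ , there b' , j  = right b' (cut-⊑-Right le j r d₂ g₁ h₁ g₂ h₂)

    cut-⊑-Left : size C ≤ n → C' ≈ C₀ → Left Γ₁ Δ₁ C₀ → Γ₂ ⊢ Δ₂ →
                 Γ₁ ⊑ Γ → Δ₁ ⊑ C ∷ Δ → Γ₂ ⊑ C ∷ Γ → Δ₂ ⊑ Δ → Left Γ Δ C'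
    cut-⊑-Left le ⊥' ⊥ᴸ d₂ g₁ h₁ g₂ h₂ = ⊥ᴸ
    cut-⊑-Left le (a ⇒ b) (⇒ᴸ d e) d₂ g₁ h₁ g₂ h₂ =
      ⇒ᴸ (cut-⊑ le d d₂ g₁ (⊑-∷-under a h₁) g₂ (⊑-weaken h₂))
         (cut-⊑ le e d₂ (⊑-∷ b g₁) h₁ (⊑-under g₂) h₂)
    cut-⊑-Left le (a ∧ b) (∧ᴸ d) d₂ g₁ h₁ g₂ h₂ =
      ∧ᴸ (cut-⊑ le d d₂ (⊑-∷ a (⊑-∷ b g₁)) h₁ (⊑-under (⊑-under g₂)) h₂)
    cut-⊑-Left le (a ∨ b) (∨ᴸ d e) d₂ g₁ h₁ g₂ h₂ =
      ∨ᴸ (cut-⊑ le d d₂ (⊑-∷ a g₁) h₁ (⊑-under g₂) h₂)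
         (cut-⊑ le e d₂ (⊑-∷ b g₁) h₁ (⊑-under g₂) h₂)
    cut-⊑-Left le (∀' a) (∀ᴸ t d) d₂ g₁ h₁ g₂ h₂ =
      ∀ᴸ t (cut-⊑ le d d₂ (⊑-∷ (≈-sub (inst-sub t) a) g₁) h₁ (⊑-under g₂) h₂)
    cut-⊑-Left le (∃' a) (∃ᴸ d) d₂ g₁ h₁ g₂ h₂ =
      ∃ᴸ (cut-⊑ (size-subP-≤ wk le) d (⊢-sub wk d₂)
                (⊑-∷ a (⊑-map wk g₁)) (⊑-map wk h₁) (⊑-under (⊑-map wk g₂)) (⊑-map wk h₂))

    cut-⊑-Right : size C ≤ n → C' ≈ C₀ → Right Γ₁ Δ₁ C₀ → Γ₂ ⊢ Δ₂ →
                  Γ₁ ⊑ Γ → Δ₁ ⊑ C ∷ Δ → Γ₂ ⊑ C ∷ Γ → Δ₂ ⊑ Δ → Right Γ Δ C'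
    cut-⊑-Right le (a ⇒ b) (⇒ᴿ d) d₂ g₁ h₁ g₂ h₂ =
      ⇒ᴿ (cut-⊑ le d d₂ (⊑-∷ a g₁) (⊑-∷-under b h₁) (⊑-under g₂) (⊑-weaken h₂))
    cut-⊑-Right le (a ∧ b) (∧ᴿ d e) d₂ g₁ h₁ g₂ h₂ =
      ∧ᴿ (cut-⊑ le d d₂ g₁ (⊑-∷-under a h₁) g₂ (⊑-weaken h₂))
         (cut-⊑ le e d₂ g₁ (⊑-∷-under b h₁) g₂ (⊑-weaken h₂))
    cut-⊑-Right le (a ∨ b) (∨ᴿ d) d₂ g₁ h₁ g₂ h₂ =
      ∨ᴿ (cut-⊑ le d d₂ g₁ (⊑-∷-under a (⊑-∷-under b h₁)) g₂ (⊑-weaken (⊑-weaken h₂)))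
    cut-⊑-Right le (∀' a) (∀ᴿ d) d₂ g₁ h₁ g₂ h₂ =
      ∀ᴿ (cut-⊑ (size-subP-≤ wk le) d (⊢-sub wk d₂)
                (⊑-map wk g₁) (⊑-∷-under a (⊑-map wk h₁)) (⊑-map wk g₂) (⊑-weaken (⊑-map wk h₂)))
    cut-⊑-Right le (∃' a) (∃ᴿ t d) d₂ g₁ h₁ g₂ h₂ =
      ∃ᴿ t (cut-⊑ le d d₂ g₁ (⊑-∷-under (≈-sub (inst-sub t) a) h₁) g₂ (⊑-weaken h₂))

    cut-Right-⊑ : size C ≤ n → Right Γ Δ C → Γ₂ ⊢ Δ₂ → Γ₂ ⊑ C ∷ Γ → Δ₂ ⊑ Δ → Γ ⊢ Δ
    cut-Right-⊑ le r (axiom a b j) g h with g a | h b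
    ... | _ , here refl , ja | _ , b' , jb =
      right b' (Right-mono (≈-sym (≈-resp ja j jb)) r ⊑-refl ⊑-refl)
    ... | _ , there a' , ja  | _ , b' , jb = axiom a' b' (≈-resp ja j jb)
    cut-Right-⊑ le r (left a l) g h with g a
    ... | _ , here refl , j = cut-principal r (cut-Right-⊑-Left le r j l g h) le
    ... | _ , there a' , j  = left a' (cut-Right-⊑-Left le r j l g h)
    cut-Right-⊑ le r (right b r₂) g h with _ , b' , j ← h b =
      right b' (cut-Right-⊑-Right le r j r₂ g h)

    cut-Right-⊑-Left : size C ≤ n → Right Γ Δ C → C' ≈ C₀ → Left Γ₂ Δ₂ C₀ →
                       Γ₂ ⊑ C ∷ Γ → Δ₂ ⊑ Δ → Left Γ Δ C'
    cut-Right-⊑-Left le r ⊥' ⊥ᴸ g h = ⊥ᴸ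
    cut-Right-⊑-Left le r (a ⇒ b) (⇒ᴸ d e) g h =
      ⇒ᴸ (cut-Right-⊑ le (Right-weakenʳ r) d g (⊑-∷ a h))
         (cut-Right-⊑ le (Right-weakenˡ r) e (⊑-∷-under b g) h)
    cut-Right-⊑-Left le r (a ∧ b) (∧ᴸ d) g h =
      ∧ᴸ (cut-Right-⊑ le (Right-weakenˡ (Right-weakenˡ r)) d (⊑-∷-under a (⊑-∷-under b g)) h)
    cut-Right-⊑-Left le r (a ∨ b) (∨ᴸ d e) g h =
      ∨ᴸ (cut-Right-⊑ le (Right-weakenˡ r) d (⊑-∷-under a g) h)
         (cut-Right-⊑ le (Right-weakenˡ r) e (⊑-∷-under b g) h)
    cut-Right-⊑-Left le r (∀' a) (∀ᴸ t d) g h =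
      ∀ᴸ t (cut-Right-⊑ le (Right-weakenˡ r) d (⊑-∷-under (≈-sub (inst-sub t) a) g) h)
    cut-Right-⊑-Left le r (∃' a) (∃ᴸ d) g h =
      ∃ᴸ (cut-Right-⊑ (size-subP-≤ wk le) (Right-weakenˡ (Right-sub wk r)) d
                      (⊑-∷-under a (⊑-map wk g)) (⊑-map wk h))

    cut-Right-⊑-Right : size C ≤ n → Right Γ Δ C → C' ≈ C₀ → Right Γ₂ Δ₂ C₀ →
                        Γ₂ ⊑ C ∷ Γ → Δ₂ ⊑ Δ → Right Γ Δ C'
    cut-Right-⊑-Right le r (a ⇒ b) (⇒ᴿ d) g h =
      ⇒ᴿ (cut-Right-⊑ le (Right-weakenˡ (Right-weakenʳ r)) d (⊑-∷-under a g) (⊑-∷ b h))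
    cut-Right-⊑-Right le r (a ∧ b) (∧ᴿ d e) g h =
      ∧ᴿ (cut-Right-⊑ le (Right-weakenʳ r) d g (⊑-∷ a h))
         (cut-Right-⊑ le (Right-weakenʳ r) e g (⊑-∷ b h))
    cut-Right-⊑-Right le r (a ∨ b) (∨ᴿ d) g h =
      ∨ᴿ (cut-Right-⊑ le (Right-weakenʳ (Right-weakenʳ r)) d g (⊑-∷ a (⊑-∷ b h)))
    cut-Right-⊑-Right le r (∀' a) (∀ᴿ d) g h =
      ∀ᴿ (cut-Right-⊑ (size-subP-≤ wk le) (Right-weakenʳ (Right-sub wk r)) d
                      (⊑-map wk g) (⊑-∷ a (⊑-map wk h)))
    cut-Right-⊑-Right le r (∃' a) (∃ᴿ t d) g h =
      ∃ᴿ t (cut-Right-⊑ le (Right-weakenʳ r) d g (⊑-∷ (≈-sub (inst-sub t) a) h))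

    cut-principal : Right Γ Δ C → Left Γ Δ C → size C ≤ n → Γ ⊢ Δ
    cut-principal (⇒ᴿ e) (⇒ᴸ f₁ f₂) (s≤s le) =
      ⊢-cut (m+n≤o⇒n≤o _ le) (⊢-cut (m+n≤o⇒m≤o _ le) (⊢-mono f₁ ⊑-refl (⊑-under ⊑-refl)) e) f₂
    cut-principal (∧ᴿ e₁ e₂) (∧ᴸ f) (s≤s le) =
      ⊢-cut (m+n≤o⇒n≤o _ le) e₂ (⊢-cut (m+n≤o⇒m≤o _ le) (⊢-weakenˡ e₁) f)
    cut-principal (∨ᴿ e) (∨ᴸ f₁ f₂) (s≤s le) =
      ⊢-cut (m+n≤o⇒n≤o _ le) (⊢-cut (m+n≤o⇒m≤o _ le) e (⊢-weakenʳ f₁)) f₂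
    cut-principal (∀ᴿ e) (∀ᴸ t f) (s≤s le) = ⊢-cut (size-subP-≤ _ le) (⊢-instʳ t e) f
    cut-principal (∃ᴿ t e) (∃ᴸ f) (s≤s le) = ⊢-cut (size-subP-≤ _ le) e (⊢-instˡ t f)

  ⊢-left : C' ↠ₚ C → Left Γ Δ C → C' ∷ Γ ⊢ Δ
  ⊢-left C'↠C l = left (here refl) (Left-mono (↠ₚ⇒≈ C'↠C) l (⊑-weaken ⊑-refl) ⊑-refl)

  ⊢-right : C' ↠ₚ C → Right Γ Δ C → Γ ⊢ C' ∷ Δ
  ⊢-right C'↠C r = right (here refl) (Right-mono (↠ₚ⇒≈ C'↠C) r ⊑-refl (⊑-weaken ⊑-refl))

  ⊑-contract : A ↠ₚ A₁ → A ↠ₚ A₂ → A₁ ∷ A₂ ∷ X ⊑ A ∷ X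
  ⊑-contract A↠A₁ A↠A₂ = ⊑-cons (here refl) (↠ₚ⇒≈ A↠A₁) (⊑-∷ (↠ₚ⇒≈ A↠A₂) ⊑-refl)

  Pf⇒⊢ : ∀ {b} → Pf R b Γ Δ → Γ ⊢ Δ
  Pf⇒⊢ (perm Γ↭ Δ↭ d)     = ⊢-mono (Pf⇒⊢ d) (↭⇒⊑ Γ↭) (↭⇒⊑ Δ↭)
  Pf⇒⊢ (axiom A₁↠A A₂↠A)  = axiom (here refl) (here refl) (≈-resp (↠ₚ⇒≈ A₁↠A) ≈-refl (↠ₚ⇒≈ A₂↠A))
  Pf⇒⊢ (cut {C = C} _ C↠C₁ C↠C₂ d e) =
    cut-⊑ {n = size C} ≤-refl (Pf⇒⊢ d) (Pf⇒⊢ e)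
          ⊑-refl (⊑-∷ (↠ₚ⇒≈ C↠C₁) ⊑-refl) (⊑-∷ (↠ₚ⇒≈ C↠C₂) ⊑-refl) ⊑-refl
  Pf⇒⊢ (contrL A↠A₁ A↠A₂ d) = ⊢-mono (Pf⇒⊢ d) (⊑-contract A↠A₁ A↠A₂) ⊑-refl
  Pf⇒⊢ (contrR A↠A₁ A↠A₂ d) = ⊢-mono (Pf⇒⊢ d) ⊑-refl (⊑-contract A↠A₁ A↠A₂)
  Pf⇒⊢ (weakL d)          = ⊢-weakenˡ (Pf⇒⊢ d)
  Pf⇒⊢ (weakR d)          = ⊢-weakenʳ (Pf⇒⊢ d)
  Pf⇒⊢ (⇒L C↠ d e)        = ⊢-left C↠ (⇒ᴸ (Pf⇒⊢ d) (Pf⇒⊢ e))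
  Pf⇒⊢ (⇒R C↠ d)          = ⊢-right C↠ (⇒ᴿ (Pf⇒⊢ d))
  Pf⇒⊢ (∧L C↠ d)          = ⊢-left C↠ (∧ᴸ (Pf⇒⊢ d))
  Pf⇒⊢ (∧R C↠ d e)        = ⊢-right C↠ (∧ᴿ (Pf⇒⊢ d) (Pf⇒⊢ e))
  Pf⇒⊢ (∨L C↠ d e)        = ⊢-left C↠ (∨ᴸ (Pf⇒⊢ d) (Pf⇒⊢ e))
  Pf⇒⊢ (∨R C↠ d)          = ⊢-right C↠ (∨ᴿ (Pf⇒⊢ d))
  Pf⇒⊢ (⊥L C↠)            = ⊢-left C↠ ⊥ᴸ
  Pf⇒⊢ (∀L t C↠ d)        = ⊢-left C↠ (∀ᴸ t (Pf⇒⊢ d))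
  Pf⇒⊢ (∀R C↠ d)          = ⊢-right C↠ (∀ᴿ (Pf⇒⊢ d))
  Pf⇒⊢ (∃L C↠ d)          = ⊢-left C↠ (∃ᴸ (Pf⇒⊢ d))
  Pf⇒⊢ (∃R t C↠ d)        = ⊢-right C↠ (∃ᴿ t (Pf⇒⊢ d))

  confluent⇒cut-redundant : CutRedundant R
  confluent⇒cut-redundant d = ⊢⇒Pf (Pf⇒⊢ d)

module AtomicSequents {S : Signature} (R : RewriteSystem {S}) where
  open Rewriting R

  private variable
    n m : ℕ
    p q : Pred S
    t u : Term {S}
    ts us : Vec (Term {S}) n
    A B C X : Prop {S}
    Γ Δ : List (Prop {S})

  Atomic : Prop {S} → Set
  Atomic (atom _ _) = ⊤
  Atomic _          = ⊥

  atom-reduct : atom p ts ↠ₚ X → ∃ λ us → X ≡ atom p us × Star (_⟶ᵛ_ R) ts us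
  atom-reduct ε                = _ , refl , ε
  atom-reduct (atomₛ s ◅ steps) with us , refl , ts↠us ← atom-reduct steps = us , refl , s ◅ ts↠us

  atom-reduct-Atomic : atom p ts ↠ₚ X → Atomic X
  atom-reduct-Atomic steps with _ , refl , _ ← atom-reduct steps = tt

  ↓ₚ-atom : atom p ts ↓ₚ atom p us → Join (_⟶ᵛ_ R) ts us
  ↓ₚ-atom (_ , P↠ , Q↠)
    with ws , refl , ts↠ws ← atom-reduct P↠ | _ , refl , us↠ws ← atom-reduct Q↠ =
    ws , ts↠ws , us↠ws

  head-↠ : Star (_⟶ᵛ_ R) (t ∷ ts) (u ∷ us) → t ↠ u
  head-↠ ε                = ε
  head-↠ (here s ◅ steps)  = s ◅ head-↠ steps
  head-↠ (there _ ◅ steps) = head-↠ steps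

  -- Reducts of atoms are atoms, so no logical rule applies and a cut-free
  -- proof can only end in an axiom.
  cut-free⇒↓ₚ : Pf R false Γ Δ → All (atom p ts ↠ₚ_) Γ → All (atom q us ↠ₚ_) Δ →
                atom p ts ↓ₚ atom q us
  cut-free⇒↓ₚ (perm Γ↭ Δ↭ d) PΓ QΔ =
    cut-free⇒↓ₚ d (All-resp-↭ (↭-sym Γ↭) PΓ) (All-resp-↭ (↭-sym Δ↭) QΔ)
  cut-free⇒↓ₚ (axiom A₁↠A A₂↠A) (P↠A₁ ∷ _) (Q↠A₂ ∷ _) = _ , P↠A₁ ◅◅ A₁↠A , Q↠A₂ ◅◅ A₂↠A
  cut-free⇒↓ₚ (contrL A↠A₁ A↠A₂ d) (P↠A ∷ PΓ) QΔ =
    cut-free⇒↓ₚ d ((P↠A ◅◅ A↠A₁) ∷ (P↠A ◅◅ A↠A₂) ∷ PΓ) QΔ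
  cut-free⇒↓ₚ (contrR A↠A₁ A↠A₂ d) PΓ (Q↠A ∷ QΔ) =
    cut-free⇒↓ₚ d PΓ ((Q↠A ◅◅ A↠A₁) ∷ (Q↠A ◅◅ A↠A₂) ∷ QΔ)
  cut-free⇒↓ₚ (weakL d) (_ ∷ PΓ) QΔ = cut-free⇒↓ₚ d PΓ QΔ
  cut-free⇒↓ₚ (weakR d) PΓ (_ ∷ QΔ) = cut-free⇒↓ₚ d PΓ QΔ
  cut-free⇒↓ₚ (⇒L C↠ _ _) (P↠C ∷ _) _ = ⊥-elim (atom-reduct-Atomic (P↠C ◅◅ C↠))
  cut-free⇒↓ₚ (⇒R C↠ _)   _ (Q↠C ∷ _) = ⊥-elim (atom-reduct-Atomic (Q↠C ◅◅ C↠))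
  cut-free⇒↓ₚ (∧L C↠ _)   (P↠C ∷ _) _ = ⊥-elim (atom-reduct-Atomic (P↠C ◅◅ C↠))
  cut-free⇒↓ₚ (∧R C↠ _ _) _ (Q↠C ∷ _) = ⊥-elim (atom-reduct-Atomic (Q↠C ◅◅ C↠))
  cut-free⇒↓ₚ (∨L C↠ _ _) (P↠C ∷ _) _ = ⊥-elim (atom-reduct-Atomic (P↠C ◅◅ C↠))
  cut-free⇒↓ₚ (∨R C↠ _)   _ (Q↠C ∷ _) = ⊥-elim (atom-reduct-Atomic (Q↠C ◅◅ C↠))
  cut-free⇒↓ₚ (⊥L C↠)     (P↠C ∷ _) _ = ⊥-elim (atom-reduct-Atomic (P↠C ◅◅ C↠))
  cut-free⇒↓ₚ (∀L _ C↠ _) (P↠C ∷ _) _ = ⊥-elim (atom-reduct-Atomic (P↠C ◅◅ C↠))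
  cut-free⇒↓ₚ (∀R C↠ _)   _ (Q↠C ∷ _) = ⊥-elim (atom-reduct-Atomic (Q↠C ◅◅ C↠))
  cut-free⇒↓ₚ (∃L C↠ _)   (P↠C ∷ _) _ = ⊥-elim (atom-reduct-Atomic (P↠C ◅◅ C↠))
  cut-free⇒↓ₚ (∃R _ C↠ _) _ (Q↠C ∷ _) = ⊥-elim (atom-reduct-Atomic (Q↠C ◅◅ C↠))

  convertible-by-cut : C ↠ₚ A → C ↠ₚ B → Pf R true (A ∷ []) (B ∷ [])
  convertible-by-cut C↠A C↠B = cut refl ε ε (axiom ε C↠A) (axiom C↠B ε)

  pad : 1 ≤ m → Term {S} → Vec (Term {S}) m
  pad {suc m} _ t = t ∷ replicate m (var 0)

  pad-↠ : (1≤m : 1 ≤ m) → t ↠ u → Star (_⟶ᵛ_ R) (pad 1≤m t) (pad 1≤m u)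
  pad-↠ {suc m} _ = gmap (_∷ replicate m (var 0)) here

  pad-↓ : (1≤m : 1 ≤ m) → Join (_⟶ᵛ_ R) (pad 1≤m t) (pad 1≤m u) → t ↓ u
  pad-↓ {suc m} _ (w ∷ _ , t↠w , u↠w) = w , head-↠ t↠w , head-↠ u↠w

  cut-redundant⇒confluent : ∃ (λ p → 1 ≤ arP S p) → CutRedundant R → Confluent R
  cut-redundant⇒confluent (p , 1≤ar) cut-redundant t↠u t↠v =
    pad-↓ 1≤ar (↓ₚ-atom (cut-free⇒↓ₚ (cut-redundant (convertible-by-cut (P↠ t↠u) (P↠ t↠v)))
                                     (ε ∷ []) (ε ∷ [])))
    where
    P↠ : t ↠ u → atom p (pad 1≤ar t) ↠ₚ atom p (pad 1≤ar u)
    P↠ t↠u = gmap (atom p) atomₛ (pad-↠ 1≤ar t↠u)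

proposition8 : {S : Signature} → ∃ (λ p → 1 ≤ arP S p) → (R : RewriteSystem {S}) →
    (CutRedundant R → Confluent R) × (Confluent R → CutRedundant R)
proposition8 signature-has-predicate R =
  AtomicSequents.cut-redundant⇒confluent R signature-has-predicate ,
  CutAdmissibility.confluent⇒cut-redundant R
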